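{- Let $d\in\mathbb{N}$ and let $G$ be a graph on $n\geq 3$ vertices with average degree at most $d$. Then the number of edges of $G$ can be reconstructed from any deck of $G$ missing at most $\frac{n}{4d+6}-d-5$ cards. That is, for every sub-multiset $\mathcal{D}'\subseteq\mathcal{D}(G)$ with $|\mathcal{D}'|\geq n-\left(\frac{n}{4d+6}-d-5\right)$, every graph $H$ on $n$ vertices with $\mathcal{D}'\subseteq\mathcal{D}(H)$ (as multisets) satisfies $|E(H)|=|E(G)|$.
   Context: All graphs are finite, simple and undirected. For a vertex $v$ of a graph $G$, the card $G-v$ is the graph obtained by deleting $v$ and all incident edges. The deck $\mathcal{D}(G)$ is the multiset of the isomorphism classes (unlabelled versions) of the cards $G-v$, $v\in V(G)$. -}

module Defs where

open import Data.Nat using (ℕ; zero; suc; _+_; _*_; _∸_; _≤_; _<ᵇ_)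
open import Data.Fin using (Fin; toℕ; punchIn)
open import Data.Fin.Permutation using (Permutation′; _⟨$⟩ʳ_)
open import Data.Bool using (Bool; true; false; _∧_; if_then_else_)
open import Data.List using (List; map; allFin)
open import Data.Nat.ListAction using (sum)
open import Data.Product using (Σ; _×_)
open import Function.Definitions using (Injective)
open import Relation.Binary.PropositionalEquality using (_≡_)

record Graph (n : ℕ) : Set where
  field
    adj   : Fin n → Fin n → Bool
    sym   : ∀ i j → adj i j ≡ adj j i
    irrfl : ∀ i → adj i i ≡ false
open Graph public

edgeCount : ∀ {n} → Graph n → ℕ
edgeCount {n} G =
  sum (map (λ i → sum (map (λ j → if (toℕ i <ᵇ toℕ j) ∧ adj G i j then 1 else 0)
                           (allFin n)))
           (allFin n))

card : ∀ {m} → Graph (suc m) → Fin (suc m) → Graph m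
card G v = record
  { adj   = λ i j → adj G (punchIn v i) (punchIn v j)
  ; sym   = λ i j → sym G (punchIn v i) (punchIn v j)
  ; irrfl = λ i → irrfl G (punchIn v i)
  }

_≅_ : ∀ {m} → Graph m → Graph m → Set
_≅_ {m} G H = Σ (Permutation′ m) λ π →
  ∀ i j → adj H (π ⟨$⟩ʳ i) (π ⟨$⟩ʳ j) ≡ adj G i j

-- A sub-multiset D' of the deck D(G) of size k is given by k distinct
-- vertices of G (an injection sel : Fin k → Fin (suc m)); the multiset is
-- the classes of the cards G - sel t.  D' ⊆ D(H) as multisets of isomorphism
-- classes iff the cards of D' can be matched injectively to cards of H
-- with isomorphic images.
SubDeckOf : ∀ {m k} → Graph (suc m) → (Fin k → Fin (suc m)) → Graph (suc m) → Set
SubDeckOf {m} {k} G sel H =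
  Σ (Fin k → Fin (suc m)) λ σ → Injective _≡_ _≡_ σ × (∀ t → card G (sel t) ≅ card H (σ t))

-- Kelly's lemma: if the cards G − v and H − w are isomorphic, then
-- deg_H w − deg_G v = |E(H)| − |E(G)|.  Suppose |E(G)| < |E(H)|, so every matched card
-- raises the degree of its vertex.  With the threshold J = 2d + 1, compare the capped
-- degree sums Σ_u min(deg u, J) of G, of H and of a common card G − v ≅ H − w: raising
-- all low-degree (< J) vertices of G by one costs at most (ℓ + 1)J for the ℓ missing
-- cards and the removed vertex, so G has at most deg_H w + (ℓ + 1)J low-degree vertices.
-- Averaging over the k matched cards, with Σ deg = 2|E| and Kelly's lemma bounding
-- |E(H)| by |E(G)|, this is about 2d + (ℓ + 1)J, whereas average degree at most d
-- leaves more than n/2 vertices of degree below J.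
module Submission where

open import Data.Bool using (Bool; true; false; _∧_; if_then_else_)
open import Data.Empty using (⊥; ⊥-elim)
open import Data.Fin using (Fin; zero; suc; toℕ; punchIn; punchOut)
open import Data.Fin.Permutation using (_⟨$⟩ʳ_; inverseʳ; flip)
open import Data.Fin.Properties
  using (¬Fin0; 0≢1+n; suc-injective; toℕ-injective; punchIn-punchOut; punchOut-injective; injective⇒≤)
open import Data.List using (map; allFin; tabulate)
open import Data.List.Properties using (map-tabulate; map-cong)
import Data.Nat.ListAction as List
open import Data.Nat
  using (ℕ; zero; suc; _+_; _*_; _∸_; _≤_; _≰_; _<_; _⊓_; _<ᵇ_; z≤n; s≤s; z<s; NonZero; >-nonZero)
open import Data.Nat.Properties hiding (0≢1+n; suc-injective)
open import Data.Nat.Solver using (module +-*-Solver)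
open +-*-Solver using (solve; _:+_; _:*_; _:=_; con)
open import Data.Product using (_,_)
open import Defs renaming (sym to adj-sym)
open import Function using (_∘_; id)
open import Function.Definitions using (Injective)
open import Relation.Binary using (tri<; tri≈; tri>)
open import Relation.Binary.PropositionalEquality
  using (_≡_; _≢_; refl; sym; trans; cong; cong₂; subst; module ≡-Reasoning)
open import Relation.Nullary using (¬_; contradiction)
open import Relation.Nullary.Reflects using (ofʸ; ofⁿ)

open import Algebra.Properties.Semiring.Sum +-*-semiring
  using (sum-syntax; sum-cong-≗; sum-remove; ∑-distrib-+; ∑-comm; ∑-permute; *-distribˡ-sum)
open import Algebra.Properties.CommutativeSemigroup +-commutativeSemigroup
  using () renaming (x∙yz≈y∙xz to m+[n+o]≡n+[m+o])
open import Algebra.Properties.CommutativeSemigroup *-commutativeSemigroup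
  using () renaming (x∙yz≈y∙xz to m*[n*o]≡n*[m*o])

∑-const : ∀ n c → ∑[ i < n ] c ≡ n * c
∑-const zero    c = refl
∑-const (suc n) c = cong (c +_) (∑-const n c)

∑-mono-≤ : ∀ {n} {f g : Fin n → ℕ} → (∀ i → f i ≤ g i) → ∑[ i < n ] f i ≤ ∑[ i < n ] g i
∑-mono-≤ {zero}  f≤g = z≤n
∑-mono-≤ {suc n} f≤g = +-mono-≤ (f≤g zero) (∑-mono-≤ (f≤g ∘ suc))

module _ {k n} (ι : Fin (suc k) → Fin (suc n)) (ι-inj : Injective _≡_ _≡_ ι) where

  private
    head≢tail : ∀ t → ι zero ≢ ι (suc t)
    head≢tail t = 0≢1+n ∘ ι-inj

  punchOutTail : Fin k → Fin n
  punchOutTail t = punchOut (head≢tail t)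

  punchIn-punchOutTail : ∀ t → punchIn (ι zero) (punchOutTail t) ≡ ι (suc t)
  punchIn-punchOutTail t = punchIn-punchOut (head≢tail t)

  punchOutTail-injective : Injective _≡_ _≡_ punchOutTail
  punchOutTail-injective e = suc-injective (ι-inj (punchOut-injective (head≢tail _) (head≢tail _) e))

∑∘injective≤∑ : ∀ {k n} {ι : Fin k → Fin n} → Injective _≡_ _≡_ ι →
  (f : Fin n → ℕ) → ∑[ t < k ] f (ι t) ≤ ∑[ u < n ] f u
∑∘injective≤∑ {zero}          _     f = z≤n
∑∘injective≤∑ {suc k} {zero}  {ι} _ f = ⊥-elim (¬Fin0 (ι zero))
∑∘injective≤∑ {suc k} {suc n} {ι} ι-inj f = begin
  f (ι zero) + ∑[ t < k ] f (ι (suc t))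
    ≡⟨ cong (f (ι zero) +_) (sum-cong-≗ (cong f ∘ punchIn-punchOutTail ι ι-inj)) ⟨
  f (ι zero) + ∑[ t < k ] f (punchIn (ι zero) (punchOutTail ι ι-inj t))
    ≤⟨ +-monoʳ-≤ _ (∑∘injective≤∑ (punchOutTail-injective ι ι-inj) (f ∘ punchIn (ι zero))) ⟩
  f (ι zero) + ∑[ u < n ] f (punchIn (ι zero) u)
    ≡⟨ sum-remove f ⟨
  ∑[ u < suc n ] f u ∎
  where open ≤-Reasoning

∑≤∑∘injective+ : ∀ {k n} {ι : Fin k → Fin n} → Injective _≡_ _≡_ ι →
  {M : ℕ} (f : Fin n → ℕ) → (∀ u → f u ≤ M) →
  ∑[ u < n ] f u ≤ ∑[ t < k ] f (ι t) + (n ∸ k) * M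
∑≤∑∘injective+ {zero}  {n}           _ {M} f f≤M = ≤-trans (∑-mono-≤ f≤M) (≤-reflexive (∑-const n M))
∑≤∑∘injective+ {suc k} {zero}  {ι}   _     f f≤M = ⊥-elim (¬Fin0 (ι zero))
∑≤∑∘injective+ {suc k} {suc n} {ι} ι-inj {M} f f≤M = begin
  ∑[ u < suc n ] f u
    ≡⟨ sum-remove f ⟩
  f (ι zero) + ∑[ u < n ] f (punchIn (ι zero) u)
    ≤⟨ +-monoʳ-≤ _ (∑≤∑∘injective+ (punchOutTail-injective ι ι-inj) (f ∘ punchIn (ι zero))
                                   (f≤M ∘ punchIn (ι zero))) ⟩
  f (ι zero) + (∑[ t < k ] f (punchIn (ι zero) (punchOutTail ι ι-inj t)) + (n ∸ k) * M)
    ≡⟨ cong (λ s → f (ι zero) + (s + (n ∸ k) * M))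
            (sum-cong-≗ (cong f ∘ punchIn-punchOutTail ι ι-inj)) ⟩
  f (ι zero) + (∑[ t < k ] f (ι (suc t)) + (n ∸ k) * M)
    ≡⟨ +-assoc (f (ι zero)) _ _ ⟨
  ∑[ t < suc k ] f (ι t) + (n ∸ k) * M ∎
  where open ≤-Reasoning

fromBool : Bool → ℕ
fromBool b = if b then 1 else 0

degree : ∀ {n} → Graph n → Fin n → ℕ
degree {n} G u = ∑[ j < n ] fromBool (adj G u j)

isUpperEdge : ∀ {n} → Graph n → Fin n → Fin n → ℕ
isUpperEdge G i j = fromBool ((toℕ i <ᵇ toℕ j) ∧ adj G i j)

sum-map-allFin : ∀ {n} (f : Fin n → ℕ) → List.sum (map f (allFin n)) ≡ ∑[ i < n ] f i
sum-map-allFin f = trans (cong List.sum (map-tabulate id f)) (sum-tabulate f)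
  where
  sum-tabulate : ∀ {n} (h : Fin n → ℕ) → List.sum (tabulate h) ≡ ∑[ i < n ] h i
  sum-tabulate {zero}  h = refl
  sum-tabulate {suc n} h = cong (h zero +_) (sum-tabulate (h ∘ suc))

edgeCount-∑ : ∀ {n} (G : Graph n) → edgeCount G ≡ ∑[ i < n ] ∑[ j < n ] isUpperEdge G i j
edgeCount-∑ {n} G = trans (cong List.sum (map-cong (sum-map-allFin ∘ isUpperEdge G) (allFin n)))
                           (sum-map-allFin {n} (λ i → ∑[ j < n ] isUpperEdge G i j))

fromBool-adj : ∀ {n} (G : Graph n) i j → fromBool (adj G i j) ≡ isUpperEdge G i j + isUpperEdge G j i
fromBool-adj G i j
  with toℕ i <ᵇ toℕ j | <ᵇ-reflects-< (toℕ i) (toℕ j) | toℕ j <ᵇ toℕ i | <ᵇ-reflects-< (toℕ j) (toℕ i)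
... | true  | ofʸ i<j  | true  | ofʸ j<i  = contradiction j<i (<⇒≯ i<j)
... | true  | _        | false | _        = sym (+-identityʳ _)
... | false | _        | true  | _        = cong fromBool (adj-sym G i j)
... | false | ofⁿ i≮j  | false | ofⁿ j≮i  =
  subst (λ j → fromBool (adj G i j) ≡ 0) (toℕ-injective (≤-antisym (≮⇒≥ j≮i) (≮⇒≥ i≮j)))
        (cong fromBool (irrfl G i))

handshake : ∀ {n} (G : Graph n) → ∑[ u < n ] degree G u ≡ 2 * edgeCount G
handshake {n} G = begin
  ∑[ i < n ] ∑[ j < n ] fromBool (adj G i j)
    ≡⟨ sum-cong-≗ (λ i → sum-cong-≗ (fromBool-adj G i)) ⟩
  ∑[ i < n ] ∑[ j < n ] (U i j + U j i)
    ≡⟨ sum-cong-≗ (λ i → ∑-distrib-+ (U i) (λ j → U j i)) ⟩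
  ∑[ i < n ] (∑[ j < n ] U i j + ∑[ j < n ] U j i)
    ≡⟨ ∑-distrib-+ (λ i → ∑[ j < n ] U i j) (λ i → ∑[ j < n ] U j i) ⟩
  E + ∑[ i < n ] ∑[ j < n ] U j i
    ≡⟨ cong (E +_) (∑-comm U) ⟨
  E + E
    ≡⟨ cong (E +_) (+-identityʳ E) ⟨
  2 * E
    ≡⟨ cong (2 *_) (edgeCount-∑ G) ⟨
  2 * edgeCount G ∎
  where
  open ≡-Reasoning
  U = isUpperEdge G
  E = ∑[ i < n ] ∑[ j < n ] U i j

degree-punchIn : ∀ {m} (G : Graph (suc m)) v i →
  degree G (punchIn v i) ≡ fromBool (adj G (punchIn v i) v) + degree (card G v) i
degree-punchIn G v i = sum-remove {i = v} (fromBool ∘ adj G (punchIn v i))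

degree-∑-punchIn : ∀ {m} (G : Graph (suc m)) v → degree G v ≡ ∑[ i < m ] fromBool (adj G (punchIn v i) v)
degree-∑-punchIn G v = trans (sum-remove {i = v} (fromBool ∘ adj G v))
  (cong₂ _+_ (cong fromBool (irrfl G v)) (sum-cong-≗ (cong fromBool ∘ adj-sym G v ∘ punchIn v)))

edgeCount-card : ∀ {m} (G : Graph (suc m)) v → degree G v + edgeCount (card G v) ≡ edgeCount G
edgeCount-card {m} G v = *-cancelˡ-≡ _ _ 2 (begin
  2 * (dv + edgeCount G-v)
    ≡⟨ 2*[a+b]≡a+[a+2*b] dv (edgeCount G-v) ⟩
  dv + (dv + 2 * edgeCount G-v)
    ≡⟨ cong₂ (λ a b → dv + (a + b)) (sym (degree-∑-punchIn G v)) (handshake G-v) ⟨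
  dv + (∑[ i < m ] fromBool (adj G (punchIn v i) v) + ∑[ i < m ] degree G-v i)
    ≡⟨ cong (dv +_) (∑-distrib-+ _ (degree G-v)) ⟨
  dv + ∑[ i < m ] (fromBool (adj G (punchIn v i) v) + degree G-v i)
    ≡⟨ cong (dv +_) (sum-cong-≗ (degree-punchIn G v)) ⟨
  dv + ∑[ i < m ] degree G (punchIn v i)
    ≡⟨ sum-remove (degree G) ⟨
  ∑[ u < suc m ] degree G u
    ≡⟨ handshake G ⟩
  2 * edgeCount G ∎)
  where
  open ≡-Reasoning
  dv = degree G v
  G-v = card G v
  2*[a+b]≡a+[a+2*b] : ∀ a b → 2 * (a + b) ≡ a + (a + 2 * b)
  2*[a+b]≡a+[a+2*b] = solve 2 (λ a b → con 2 :* (a :+ b) := a :+ (a :+ con 2 :* b)) refl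

≅-sym : ∀ {m} {C D : Graph m} → C ≅ D → D ≅ C
≅-sym {D = D} (π , π-adj) = flip π , λ i j →
  trans (sym (π-adj _ _)) (cong₂ (adj D) (inverseʳ π) (inverseʳ π))

≅⇒degree : ∀ {m} {C D : Graph m} ((π , _) : C ≅ D) i → degree D (π ⟨$⟩ʳ i) ≡ degree C i
≅⇒degree {D = D} (π , π-adj) i =
  trans (∑-permute (fromBool ∘ adj D (π ⟨$⟩ʳ i)) π) (sum-cong-≗ (cong fromBool ∘ π-adj i))

≅⇒∑-degree : ∀ {m} {C D : Graph m} → C ≅ D → (g : ℕ → ℕ) →
  ∑[ i < m ] g (degree C i) ≡ ∑[ i < m ] g (degree D i)
≅⇒∑-degree {C = C} {D} C≅D@(π , _) g =
  trans (sum-cong-≗ (cong g ∘ sym ∘ ≅⇒degree {C = C} {D} C≅D)) (sym (∑-permute (g ∘ degree D) π))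

≅⇒edgeCount≡ : ∀ {m} {C D : Graph m} → C ≅ D → edgeCount C ≡ edgeCount D
≅⇒edgeCount≡ {C = C} {D} C≅D =
  *-cancelˡ-≡ _ _ 2 (trans (sym (handshake C)) (trans (≅⇒∑-degree {C = C} {D} C≅D id) (handshake D)))

card≅⇒degree+edgeCount≡ : ∀ {m} (X Y : Graph (suc m)) {v w} → card X v ≅ card Y w →
  degree Y w + edgeCount X ≡ degree X v + edgeCount Y
card≅⇒degree+edgeCount≡ X Y {v} {w} X-v≅Y-w = begin
  degree Y w + edgeCount X
    ≡⟨ cong (degree Y w +_) (edgeCount-card X v) ⟨
  degree Y w + (degree X v + edgeCount (card X v))
    ≡⟨ cong (λ e → degree Y w + (degree X v + e)) (≅⇒edgeCount≡ {C = card X v} {card Y w} X-v≅Y-w) ⟩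
  degree Y w + (degree X v + edgeCount (card Y w))
    ≡⟨ m+[n+o]≡n+[m+o] (degree Y w) (degree X v) _ ⟩
  degree X v + (degree Y w + edgeCount (card Y w))
    ≡⟨ cong (degree X v +_) (edgeCount-card Y w) ⟩
  degree X v + edgeCount Y ∎
  where open ≡-Reasoning

card≅⇒degree<degree : ∀ {m} (X Y : Graph (suc m)) {v w} → edgeCount X < edgeCount Y →
  card X v ≅ card Y w → degree X v < degree Y w
card≅⇒degree<degree X Y {v} {w} EX<EY X-v≅Y-w = +-cancelʳ-< (edgeCount X) _ _ (begin-strict
  degree X v + edgeCount X <⟨ +-monoʳ-< (degree X v) EX<EY ⟩
  degree X v + edgeCount Y ≡⟨ card≅⇒degree+edgeCount≡ X Y X-v≅Y-w ⟨
  degree Y w + edgeCount X ∎)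
  where open ≤-Reasoning

suc-⊓ : ∀ x J → suc x ⊓ J ≡ x ⊓ J + fromBool (x <ᵇ J)
suc-⊓ zero    zero    = refl
suc-⊓ (suc x) zero    = refl
suc-⊓ zero    (suc J) = refl
suc-⊓ (suc x) (suc J) = cong suc (suc-⊓ x J)

⊓-+-≤ : ∀ a b J → (a + b) ⊓ J ≤ a + b ⊓ J
⊓-+-≤ a b J = ≤-trans (⊓-monoʳ-≤ (a + b) (m≤n+m J a)) (≤-reflexive (sym (+-distribˡ-⊓ a b J)))

≤-+-*-fromBool-<ᵇ : ∀ x J → J ≤ x + J * fromBool (x <ᵇ J)
≤-+-*-fromBool-<ᵇ x J with x <ᵇ J | <ᵇ-reflects-< x J
... | true  | _        = ≤-trans (≤-reflexive (sym (*-identityʳ J))) (m≤n+m (J * 1) x)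
... | false | ofⁿ x≮J = ≤-trans (≮⇒≥ x≮J) (m≤m+n x (J * 0))

cappedDegreeSum : ∀ {n} → ℕ → Graph n → ℕ
cappedDegreeSum {n} J G = ∑[ u < n ] (degree G u ⊓ J)

lowDegreeCount : ∀ {n} → ℕ → Graph n → ℕ
lowDegreeCount {n} J G = ∑[ u < n ] fromBool (degree G u <ᵇ J)

∑-suc-degree-⊓ : ∀ {n} J (G : Graph n) →
  ∑[ u < n ] (suc (degree G u) ⊓ J) ≡ cappedDegreeSum J G + lowDegreeCount J G
∑-suc-degree-⊓ J G = trans (sum-cong-≗ (λ u → suc-⊓ (degree G u) J))
  (∑-distrib-+ (λ u → degree G u ⊓ J) (λ u → fromBool (degree G u <ᵇ J)))

n*J≤2*edgeCount+J*lowDegreeCount : ∀ {n} J (G : Graph n) → n * J ≤ 2 * edgeCount G + J * lowDegreeCount J G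
n*J≤2*edgeCount+J*lowDegreeCount {n} J G = begin
  n * J
    ≡⟨ ∑-const n J ⟨
  ∑[ u < n ] J
    ≤⟨ ∑-mono-≤ (λ u → ≤-+-*-fromBool-<ᵇ (degree G u) J) ⟩
  ∑[ u < n ] (degree G u + J * fromBool (degree G u <ᵇ J))
    ≡⟨ ∑-distrib-+ (degree G) _ ⟩
  ∑[ u < n ] degree G u + ∑[ u < n ] (J * fromBool (degree G u <ᵇ J))
    ≡⟨ cong₂ _+_ (handshake G) (sym (*-distribˡ-sum J (λ u → fromBool (degree G u <ᵇ J)))) ⟩
  2 * edgeCount G + J * lowDegreeCount J G ∎
  where open ≤-Reasoning

cappedDegreeSum-card-≤ : ∀ {m} J (G : Graph (suc m)) v → cappedDegreeSum J (card G v) ≤ cappedDegreeSum J G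
cappedDegreeSum-card-≤ {m} J G v = begin
  ∑[ i < m ] (degree (card G v) i ⊓ J)
    ≤⟨ ∑-mono-≤ (λ i → ⊓-monoˡ-≤ J (≤-trans (m≤n+m _ _) (≤-reflexive (sym (degree-punchIn G v i))))) ⟩
  ∑[ i < m ] (degree G (punchIn v i) ⊓ J)
    ≤⟨ m≤n+m _ _ ⟩
  degree G v ⊓ J + ∑[ i < m ] (degree G (punchIn v i) ⊓ J)
    ≡⟨ sum-remove (λ u → degree G u ⊓ J) ⟨
  cappedDegreeSum J G ∎
  where open ≤-Reasoning

cappedDegreeSum-≤-card : ∀ {m} J (G : Graph (suc m)) v →
  cappedDegreeSum J G ≤ J + (degree G v + cappedDegreeSum J (card G v))
cappedDegreeSum-≤-card {m} J G v = begin
  cappedDegreeSum J G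
    ≡⟨ sum-remove (λ u → degree G u ⊓ J) ⟩
  degree G v ⊓ J + ∑[ i < m ] (degree G (punchIn v i) ⊓ J)
    ≤⟨ +-mono-≤ (m⊓n≤n (degree G v) J) (∑-mono-≤ λ i →
         ≤-trans (≤-reflexive (cong (_⊓ J) (degree-punchIn G v i)))
                 (⊓-+-≤ (fromBool (adj G (punchIn v i) v)) (degree (card G v) i) J)) ⟩
  J + ∑[ i < m ] (fromBool (adj G (punchIn v i) v) + degree (card G v) i ⊓ J)
    ≡⟨ cong (J +_) (∑-distrib-+ (λ i → fromBool (adj G (punchIn v i) v))
                                (λ i → degree (card G v) i ⊓ J)) ⟩
  J + (∑[ i < m ] fromBool (adj G (punchIn v i) v) + cappedDegreeSum J (card G v))
    ≡⟨ cong (λ s → J + (s + cappedDegreeSum J (card G v))) (degree-∑-punchIn G v) ⟨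
  J + (degree G v + cappedDegreeSum J (card G v)) ∎
  where open ≤-Reasoning

size-bound⇒4+ℓ≤k : ∀ d ℓ k → (ℓ + d + 5) * (4 * d + 6) ≤ k + ℓ → 4 + ℓ ≤ k
size-bound⇒4+ℓ≤k d ℓ k bound = +-cancelʳ-≤ ℓ _ _ (begin
  4 + ℓ + ℓ
    ≤⟨ m≤m+n (4 + ℓ + ℓ) (4 * ℓ + 26) ⟩
  4 + ℓ + ℓ + (4 * ℓ + 26)
    ≡⟨ solve 1 (λ ℓ → con 4 :+ ℓ :+ ℓ :+ (con 4 :* ℓ :+ con 26) := (ℓ :+ con 5) :* con 6) refl ℓ ⟩
  (ℓ + 5) * 6
    ≤⟨ *-mono-≤ (+-monoˡ-≤ 5 (m≤m+n ℓ d)) (m≤n+m 6 (4 * d)) ⟩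
  (ℓ + d + 5) * (4 * d + 6)
    ≤⟨ bound ⟩
  k + ℓ ∎)
  where open ≤-Reasoning

size-bound⇒J[K+2d]<n[d+1] : ∀ d ℓ n → (ℓ + d + 5) * (4 * d + 6) ≤ n →
  suc (2 * d) * (suc ℓ * suc (2 * d) + 2 * d) < n * suc d
size-bound⇒J[K+2d]<n[d+1] d ℓ n bound = begin-strict
  J * (suc ℓ * J + 2 * d)
    <⟨ m<m+n _ z<s ⟩
  J * (suc ℓ * J + 2 * d) + suc (ℓ * (6 * d + 5) + (4 * d * d * d + 22 * d * d + 50 * d + 28))
    ≡⟨ solve 2 (λ d ℓ → let J = con 1 :+ con 2 :* d in
         J :* ((con 1 :+ ℓ) :* J :+ con 2 :* d)
           :+ (con 1 :+ (ℓ :* (con 6 :* d :+ con 5)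
                         :+ (con 4 :* d :* d :* d :+ con 22 :* d :* d :+ con 50 :* d :+ con 28)))
         := (ℓ :+ d :+ con 5) :* (con 4 :* d :+ con 6) :* (con 1 :+ d)) refl d ℓ ⟩
  (ℓ + d + 5) * (4 * d + 6) * suc d
    ≤⟨ *-monoˡ-≤ (suc d) bound ⟩
  n * suc d ∎
  where
  open ≤-Reasoning
  J = suc (2 * d)

-- k = 2 + q cards are matched and n = k + ℓ; eX and eY are the edge counts of the two
-- graphs, L the number of low-degree vertices of the first one and P the degree sum in
-- the second one over the matched vertices.
module EdgeExcess (d ℓ q : ℕ) .{{_ : NonZero q}} (eX eY L P : ℕ) where

  private
    k n J K : ℕ
    k = 2 + q
    n = k + ℓ
    J = suc (2 * d)
    K = suc ℓ * J

  q*eY≤k*eX : k * eY ≤ P + k * eX → P ≤ 2 * eY → q * eY ≤ k * eX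
  q*eY≤k*eX keY≤P+keX P≤2eY = +-cancelˡ-≤ (2 * eY) _ _ (begin
    2 * eY + q * eY  ≡⟨ *-distribʳ-+ eY 2 q ⟨
    k * eY           ≤⟨ keY≤P+keX ⟩
    P + k * eX       ≤⟨ +-monoˡ-≤ (k * eX) P≤2eY ⟩
    2 * eY + k * eX  ∎)
    where open ≤-Reasoning

  q*L≤q*K+2eX : k * L ≤ P + k * K → P ≤ 2 * eY → q * eY ≤ k * eX → q * L ≤ q * K + 2 * eX
  q*L≤q*K+2eX kL≤P+kK P≤2eY qeY≤keX = *-cancelˡ-≤ k (begin
    k * (q * L)
      ≡⟨ m*[n*o]≡n*[m*o] k q L ⟩
    q * (k * L)
      ≤⟨ *-monoʳ-≤ q kL≤P+kK ⟩
    q * (P + k * K)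
      ≤⟨ *-monoʳ-≤ q (+-monoˡ-≤ (k * K) P≤2eY) ⟩
    q * (2 * eY + k * K)
      ≡⟨ solve 4 (λ q k y K → q :* (con 2 :* y :+ k :* K) := con 2 :* (q :* y) :+ k :* (q :* K)) refl q k eY K ⟩
    2 * (q * eY) + k * (q * K)
      ≤⟨ +-monoˡ-≤ (k * (q * K)) (*-monoʳ-≤ 2 qeY≤keX) ⟩
    2 * (k * eX) + k * (q * K)
      ≡⟨ solve 4 (λ q k x K → con 2 :* (k :* x) :+ k :* (q :* K) := k :* (q :* K :+ con 2 :* x)) refl q k eX K ⟩
    k * (q * K + 2 * eX) ∎)
    where open ≤-Reasoning

  q*n[d+1]≤J[qK+dn] : n * J ≤ 2 * eX + J * L → q * L ≤ q * K + 2 * eX → 2 * eX ≤ d * n →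
    q * (n * suc d) ≤ J * (q * K + d * n)
  q*n[d+1]≤J[qK+dn] nJ≤2eX+JL qL≤qK+2eX 2eX≤dn = +-cancelˡ-≤ (q * (d * n)) _ _ (begin
    q * (d * n) + q * (n * suc d)
      ≡⟨ solve 3 (λ d q n → q :* (d :* n) :+ q :* (n :* (con 1 :+ d)) := q :* (n :* (con 1 :+ con 2 :* d)))
           refl d q n ⟩
    q * (n * J)
      ≤⟨ *-monoʳ-≤ q nJ≤2eX+JL ⟩
    q * (2 * eX + J * L)
      ≡⟨ solve 4 (λ q J x L → q :* (con 2 :* x :+ J :* L) := q :* (con 2 :* x) :+ J :* (q :* L)) refl q J eX L ⟩
    q * (2 * eX) + J * (q * L)
      ≤⟨ +-mono-≤ (*-monoʳ-≤ q 2eX≤dn) (*-monoʳ-≤ J qL≤qK+2eX) ⟩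
    q * (d * n) + J * (q * K + 2 * eX)
      ≤⟨ +-monoʳ-≤ (q * (d * n)) (*-monoʳ-≤ J (+-monoʳ-≤ (q * K) 2eX≤dn)) ⟩
    q * (d * n) + J * (q * K + d * n) ∎)
    where open ≤-Reasoning

  q*n[d+1]≰J[qK+dn] : n ≤ 2 * q → J * (K + 2 * d) < n * suc d → q * (n * suc d) ≰ J * (q * K + d * n)
  q*n[d+1]≰J[qK+dn] n≤2q J[K+2d]<n[d+1] q*n[d+1]≤J[qK+dn] = <-irrefl refl (begin-strict
    2 * (q * (n * suc d))
      ≤⟨ *-monoʳ-≤ 2 q*n[d+1]≤J[qK+dn] ⟩
    2 * (J * (q * K + d * n))
      ≡⟨ solve 5 (λ J q K d n → con 2 :* (J :* (q :* K :+ d :* n))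
                               := q :* (con 2 :* (J :* K)) :+ n :* (con 2 :* d :* J)) refl J q K d n ⟩
    q * (2 * (J * K)) + n * (2 * d * J)
      ≤⟨ +-monoʳ-≤ (q * (2 * (J * K))) (*-monoˡ-≤ (2 * d * J) n≤2q) ⟩
    q * (2 * (J * K)) + 2 * q * (2 * d * J)
      ≡⟨ solve 4 (λ J q K d → q :* (con 2 :* (J :* K)) :+ con 2 :* q :* (con 2 :* d :* J)
                             := q :* (con 2 :* (J :* (K :+ con 2 :* d)))) refl J q K d ⟩
    q * (2 * (J * (K + 2 * d)))
      <⟨ *-monoʳ-< q (*-monoʳ-< 2 J[K+2d]<n[d+1]) ⟩
    q * (2 * (n * suc d))
      ≡⟨ m*[n*o]≡n*[m*o] q 2 _ ⟩
    2 * (q * (n * suc d)) ∎)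
    where open ≤-Reasoning

edge-excess-inconsistent : ∀ d ℓ k n {eX eY L P} → k + ℓ ≡ n →
  (ℓ + d + 5) * (4 * d + 6) ≤ n → 2 * eX ≤ d * n →
  k * eY ≤ P + k * eX → P ≤ 2 * eY → k * L ≤ P + k * (suc ℓ * suc (2 * d)) →
  n * suc (2 * d) ≤ 2 * eX + suc (2 * d) * L → ⊥
edge-excess-inconsistent d ℓ k _ {eX} {eY} {L} {P} refl bound 2eX≤dn keY≤P+keX P≤2eY kL≤P+kK nJ≤2eX+JL
  with q , refl ← m≤n⇒∃[o]m+o≡n (≤-trans (s≤s (s≤s z≤n)) (size-bound⇒4+ℓ≤k d ℓ k bound)) =
  q*n[d+1]≰J[qK+dn] n≤2q (size-bound⇒J[K+2d]<n[d+1] d ℓ (k + ℓ) bound)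
    (q*n[d+1]≤J[qK+dn] nJ≤2eX+JL (q*L≤q*K+2eX kL≤P+kK P≤2eY (q*eY≤k*eX keY≤P+keX P≤2eY)) 2eX≤dn)
  where
  2+ℓ≤q : 2 + ℓ ≤ q
  2+ℓ≤q = +-cancelˡ-≤ 2 _ _ (size-bound⇒4+ℓ≤k d ℓ k bound)
  instance
    _ : NonZero q
    _ = >-nonZero (≤-trans z<s 2+ℓ≤q)
  open EdgeExcess d ℓ q eX eY L P
  n≤2q : 2 + q + ℓ ≤ 2 * q
  n≤2q = begin
    2 + q + ℓ    ≡⟨ solve 2 (λ q ℓ → con 2 :+ q :+ ℓ := q :+ (con 2 :+ ℓ)) refl q ℓ ⟩
    q + (2 + ℓ)  ≤⟨ +-monoʳ-≤ q 2+ℓ≤q ⟩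
    q + q        ≡⟨ cong (q +_) (+-identityʳ q) ⟨
    2 * q        ∎
    where open ≤-Reasoning

module _ {m k} (X Y : Graph (suc m)) {sel σ : Fin k → Fin (suc m)}
         (sel-inj : Injective _≡_ _≡_ sel) (σ-inj : Injective _≡_ _≡_ σ)
         (cards≅ : ∀ t → card X (sel t) ≅ card Y (σ t)) where

  k*edgeCount-≤ : k * edgeCount Y ≤ ∑[ t < k ] degree Y (σ t) + k * edgeCount X
  k*edgeCount-≤ = begin
    k * edgeCount Y
      ≡⟨ ∑-const k (edgeCount Y) ⟨
    ∑[ t < k ] edgeCount Y
      ≤⟨ ∑-mono-≤ (λ t → m≤n+m (edgeCount Y) (degree X (sel t))) ⟩
    ∑[ t < k ] (degree X (sel t) + edgeCount Y)
      ≡⟨ sum-cong-≗ (λ t → card≅⇒degree+edgeCount≡ X Y {sel t} {σ t} (cards≅ t)) ⟨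
    ∑[ t < k ] (degree Y (σ t) + edgeCount X)
      ≡⟨ ∑-distrib-+ (degree Y ∘ σ) (λ _ → edgeCount X) ⟩
    ∑[ t < k ] degree Y (σ t) + ∑[ t < k ] edgeCount X
      ≡⟨ cong (∑[ t < k ] degree Y (σ t) +_) (∑-const k (edgeCount X)) ⟩
    ∑[ t < k ] degree Y (σ t) + k * edgeCount X ∎
    where open ≤-Reasoning

  ∑-degree∘σ-≤ : ∑[ t < k ] degree Y (σ t) ≤ 2 * edgeCount Y
  ∑-degree∘σ-≤ = ≤-trans (∑∘injective≤∑ σ-inj (degree Y)) (≤-reflexive (handshake Y))

  lowDegreeCount-≤ : ∀ J → edgeCount X < edgeCount Y → ∀ t →
    lowDegreeCount J X ≤ degree Y (σ t) + suc (suc m ∸ k) * J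
  lowDegreeCount-≤ J EX<EY t = +-cancelˡ-≤ (cappedDegreeSum J X) _ _ (begin
    cappedDegreeSum J X + lowDegreeCount J X
      ≡⟨ ∑-suc-degree-⊓ J X ⟨
    ∑[ u < suc m ] (suc (degree X u) ⊓ J)
      ≤⟨ ∑≤∑∘injective+ sel-inj (λ u → suc (degree X u) ⊓ J) (λ u → m⊓n≤n _ J) ⟩
    ∑[ t < k ] (suc (degree X (sel t)) ⊓ J) + ℓ * J
      ≤⟨ +-monoˡ-≤ (ℓ * J) (∑-mono-≤ λ t →
           ⊓-monoˡ-≤ J (card≅⇒degree<degree X Y EX<EY (cards≅ t))) ⟩
    ∑[ t < k ] (degree Y (σ t) ⊓ J) + ℓ * J
      ≤⟨ +-monoˡ-≤ (ℓ * J) (∑∘injective≤∑ σ-inj (λ u → degree Y u ⊓ J)) ⟩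
    cappedDegreeSum J Y + ℓ * J
      ≤⟨ +-monoˡ-≤ (ℓ * J) (cappedDegreeSum-≤-card J Y w) ⟩
    J + (degree Y w + cappedDegreeSum J (card Y w)) + ℓ * J
      ≡⟨ cong (λ c → J + (degree Y w + c) + ℓ * J)
              (≅⇒∑-degree {C = card X s} {card Y w} (cards≅ t) (_⊓ J)) ⟨
    J + (degree Y w + cappedDegreeSum J (card X s)) + ℓ * J
      ≤⟨ +-monoˡ-≤ (ℓ * J) (+-monoʳ-≤ J (+-monoʳ-≤ (degree Y w) (cappedDegreeSum-card-≤ J X s))) ⟩
    J + (degree Y w + cappedDegreeSum J X) + ℓ * J
      ≡⟨ rearrange J (degree Y w) (cappedDegreeSum J X) (ℓ * J) ⟩
    cappedDegreeSum J X + (degree Y w + suc ℓ * J) ∎)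
    where
    open ≤-Reasoning
    ℓ = suc m ∸ k
    s = sel t
    w = σ t
    rearrange : ∀ a b c x → a + (b + c) + x ≡ c + (b + (a + x))
    rearrange = solve 4 (λ a b c x → a :+ (b :+ c) :+ x := c :+ (b :+ (a :+ x))) refl

  k*lowDegreeCount-≤ : ∀ J → edgeCount X < edgeCount Y →
    k * lowDegreeCount J X ≤ ∑[ t < k ] degree Y (σ t) + k * (suc (suc m ∸ k) * J)
  k*lowDegreeCount-≤ J EX<EY = begin
    k * lowDegreeCount J X
      ≡⟨ ∑-const k (lowDegreeCount J X) ⟨
    ∑[ t < k ] lowDegreeCount J X
      ≤⟨ ∑-mono-≤ (lowDegreeCount-≤ J EX<EY) ⟩
    ∑[ t < k ] (degree Y (σ t) + c)
      ≡⟨ ∑-distrib-+ (degree Y ∘ σ) (λ _ → c) ⟩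
    ∑[ t < k ] degree Y (σ t) + ∑[ t < k ] c
      ≡⟨ cong (∑[ t < k ] degree Y (σ t) +_) (∑-const k c) ⟩
    ∑[ t < k ] degree Y (σ t) + k * c ∎
    where
    open ≤-Reasoning
    c = suc (suc m ∸ k) * J

  edgeCount-≮ : ∀ d → 2 * edgeCount X ≤ d * suc m → (suc m ∸ k + d + 5) * (4 * d + 6) ≤ suc m →
    ¬ edgeCount X < edgeCount Y
  edgeCount-≮ d 2E≤dn bound EX<EY =
    edge-excess-inconsistent d (suc m ∸ k) k (suc m) (m+[n∸m]≡n (injective⇒≤ sel-inj)) bound 2E≤dn
      k*edgeCount-≤ ∑-degree∘σ-≤ (k*lowDegreeCount-≤ J EX<EY) (n*J≤2*edgeCount+J*lowDegreeCount J X)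
    where J = suc (2 * d)

theorem1p3 : (d m : ℕ) → 2 ≤ m → (G : Graph (suc m)) → 2 * edgeCount G ≤ d * suc m →
    (k : ℕ) → (sel : Fin k → Fin (suc m)) → Injective _≡_ _≡_ sel →
    (suc m ∸ k + d + 5) * (4 * d + 6) ≤ suc m →
    (H : Graph (suc m)) → SubDeckOf G sel H → edgeCount H ≡ edgeCount G
theorem1p3 d m _ G 2EG≤dn k sel sel-inj bound H (σ , σ-inj , cards≅)
  with <-cmp (edgeCount H) (edgeCount G)
... | tri≈ _ EH≡EG _ = EH≡EG
... | tri< EH<EG _ _ = contradiction EH<EG
  (edgeCount-≮ H G σ-inj sel-inj (λ t → ≅-sym {C = card G (sel t)} {card H (σ t)} (cards≅ t)) d
    (≤-trans (*-monoʳ-≤ 2 (<⇒≤ EH<EG)) 2EG≤dn) bound)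
... | tri> _ _ EG<EH = contradiction EG<EH (edgeCount-≮ G H sel-inj σ-inj cards≅ d 2EG≤dn bound)
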